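{- Let $n\ge 3$ be an integer, $M=(n-1)^{n-1}$, and for integers $x\ge 0$ let $$\Delta_n(x)=S_{n,0}(x)-S_{n,0}\big(M\lfloor x/M\rfloor\big).$$ Then the sequence $\big((-1)^{s_{n-1}(x)}\Delta_n(x)\big)_{x\ge 0}$ is periodic with period $n(n-1)^{n-1}$.
   Context: For an integer $b\ge 2$ and integer $r\ge 0$, $s_b(r)$ denotes the sum of the digits of $r$ in base $b$. For integers $n\ge 3$, $0\le j\le n-1$ and $x\ge 0$, define $$S_{n,j}(x)=\sum_{0\le r<x,\; r\equiv j \pmod n}(-1)^{s_{n-1}(r)}.$$ -}

module Defs where

open import Data.Nat using (ℕ; zero; suc; _+_; _*_; _∸_; _^_; _≡ᵇ_; NonZero)
open import Data.Nat.DivMod using (_/_; _%_)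
open import Data.Nat.Properties using (m^n≢0)
open import Data.Bool using (Bool; true; false; if_then_else_)
open import Data.Integer using (ℤ; +_; -_) renaming (_+_ to _+ℤ_; _*_ to _*ℤ_; _-_ to _-ℤ_)

-- digit sum of r in base b, computed with fuel (fuel r suffices since r / b < r for b ≥ 2, r > 0)
digitSumFuel : (b : ℕ) → .{{NonZero b}} → ℕ → ℕ → ℕ
digitSumFuel b zero    r = 0
digitSumFuel b (suc k) zero = 0
digitSumFuel b (suc k) r@(suc _) = r % b + digitSumFuel b k (r / b)

s : (b : ℕ) → .{{NonZero b}} → ℕ → ℕ
s b r = digitSumFuel b r r

sgn : ℕ → ℤ
sgn zero = + 1
sgn (suc k) = - sgn k

-- S_{n,j}(x) = Σ_{0 ≤ r < x, r ≡ j (mod n)} (-1)^{s_{n-1}(r)}.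
-- Defined for all n, but only meaningful for n ≥ 3; for n ≤ 1 it is set to 0 (never used).
S : ℕ → ℕ → ℕ → ℤ
S zero j x = + 0
S (suc zero) j x = + 0
S n@(suc (suc k)) j zero = + 0
S n@(suc (suc k)) j (suc x) =
  S n j x +ℤ (if (x % n) ≡ᵇ j then sgn (s (suc k) x) else + 0)

M : ℕ → ℕ
M n = (n ∸ 1) ^ (n ∸ 1)

-- Δ_n(x) = S_{n,0}(x) - S_{n,0}(M ⌊x/M⌋)   (n ≥ 3; junk value 0 for n ≤ 1)
Δ : ℕ → ℕ → ℤ
Δ zero x = + 0
Δ (suc zero) x = + 0
Δ n@(suc (suc k)) x = S n 0 x -ℤ S n 0 (M n * (x / M n))
  where instance _ = m^n≢0 (suc k) (suc k)

f : ℕ → ℕ → ℤ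
f zero x = + 0
f (suc zero) x = + 0
f n@(suc (suc k)) x = sgn (s (suc k) x) *ℤ Δ n x

module Submission where

-- Write b = n - 1 and χ(r) = (-1)^{s_b(r)}, and split x = t + q·M with t < M.
-- Since M = b^b, the base-b digits of t + q·M are those of t followed by
-- those of q, so χ(u + q·M) = χ(u)·χ(q) for every u < M.  The difference
-- Δ_n(x) = S_{n,0}(t + q·M) - S_{n,0}(q·M) is the partial sum over the block
-- r = u + q·M, u < t, so χ(q) factors out of it; it cancels against the
-- χ(q) inside χ(x) = χ(t)·χ(q), leaving
--     f(t + q·M) = χ(t) · Σ_{u<t, n ∣ u + q·M} χ(u).
-- The right-hand side depends on q only through the divisibility condition,
-- which is unchanged by q ↦ q + n because n ∣ n·M; this is the theorem.

open import Defs
open import Data.Nat using (ℕ; _+_; _*_; _^_; _∸_; _≤_)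
open import Data.Integer using (ℤ)
open import Relation.Binary.PropositionalEquality using (_≡_)

open import Data.Nat using (zero; suc; _<_; z≤n; s≤s; _≡ᵇ_; NonZero)
import Data.Nat.Properties as ℕP
open import Data.Nat.DivMod
open import Data.Nat.Divisibility using (divides-refl)
import Data.Nat.Solver as ℕSolver
open import Data.Integer using (+_; -_) renaming (_+_ to _+ℤ_; _*_ to _*ℤ_; _-_ to _-ℤ_)
import Data.Integer.Properties as ℤP
import Data.Integer.Solver as ℤSolver
open import Data.Bool using (Bool; true; false; if_then_else_)
open import Relation.Binary.PropositionalEquality using (refl; sym; trans; cong; cong₂; module ≡-Reasoning)

Σ< : ℕ → (ℕ → ℤ) → ℤ
Σ< zero    g = + 0
Σ< (suc t) g = Σ< t g +ℤ g t

Σ<-cong : ∀ t {g h : ℕ → ℤ} → (∀ u → u < t → g u ≡ h u) → Σ< t g ≡ Σ< t h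
Σ<-cong zero    eq = refl
Σ<-cong (suc t) eq =
  cong₂ _+ℤ_ (Σ<-cong t (λ u u<t → eq u (ℕP.m<n⇒m<1+n u<t))) (eq t ℕP.≤-refl)

Σ<-scale : ∀ c t (g : ℕ → ℤ) → Σ< t (λ u → c *ℤ g u) ≡ c *ℤ Σ< t g
Σ<-scale c zero    g = sym (ℤP.*-zeroʳ c)
Σ<-scale c (suc t) g =
  trans (cong (_+ℤ c *ℤ g t) (Σ<-scale c t g)) (sym (ℤP.*-distribˡ-+ c (Σ< t g) (g t)))

quotient-unique : ∀ {m} .{{_ : NonZero m}} q {t} → t < m → (t + q * m) / m ≡ q
quotient-unique {m} q {t} t<m = begin
  (t + q * m) / m    ≡⟨ +-distrib-/-∣ʳ t (divides-refl q) ⟩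
  t / m + q * m / m  ≡⟨ cong₂ _+_ (m<n⇒m/n≡0 t<m) (m*n/n≡m q m) ⟩
  q                  ∎
  where open ≡-Reasoning

module Digits (c : ℕ) where
  b : ℕ
  b = suc (suc c)

  1<b : 1 < b
  1<b = s≤s (s≤s z≤n)

  fuel-irrelevant : ∀ k k' r → r ≤ k → r ≤ k' → digitSumFuel b k r ≡ digitSumFuel b k' r
  fuel-irrelevant zero    zero     zero    _ _ = refl
  fuel-irrelevant zero    (suc k') zero    _ _ = refl
  fuel-irrelevant (suc k) zero     zero    _ _ = refl
  fuel-irrelevant (suc k) (suc k') zero    _ _ = refl
  fuel-irrelevant (suc k) (suc k') (suc r) r≤k r≤k' =
    cong (λ v → suc r % b + v) (fuel-irrelevant k k' (suc r / b) (shrink r≤k) (shrink r≤k'))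
    where
    shrink : ∀ {l} → suc r ≤ suc l → suc r / b ≤ l
    shrink r≤l = ℕP.≤-pred (ℕP.<-≤-trans (m/n<m (suc r) b 1<b) r≤l)

  s-step : ∀ r → s b r ≡ r % b + s b (r / b)
  s-step zero    = refl
  s-step (suc r) = cong (λ v → suc r % b + v)
    (fuel-irrelevant r (suc r / b) (suc r / b) (ℕP.≤-pred (m/n<m (suc r) b 1<b)) ℕP.≤-refl)

  -- If u has at most K digits, the digits of u + q·b^K are those of u
  -- followed by those of q.
  s-block : ∀ K q u → u < b ^ K → s b (u + q * b ^ K) ≡ s b u + s b q
  s-block zero    q zero    _          = cong (s b) (ℕP.*-identityʳ q)
  s-block zero    q (suc u) (s≤s ())
  s-block (suc K) q u       u<b^[1+K] = begin
    s b (u + q * b ^ suc K)                ≡⟨ cong (λ v → s b (u + v)) regroup ⟩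
    s b (u + q * b ^ K * b)                ≡⟨ s-step (u + q * b ^ K * b) ⟩
    (u + q * b ^ K * b) % b
      + s b ((u + q * b ^ K * b) / b)      ≡⟨ cong₂ (λ d w → d + s b w) ([m+kn]%n≡m%n u (q * b ^ K) b) shift ⟩
    u % b + s b (u / b + q * b ^ K)        ≡⟨ cong (λ v → u % b + v) (s-block K q (u / b) u/b<b^K) ⟩
    u % b + (s b (u / b) + s b q)          ≡⟨ sym (ℕP.+-assoc (u % b) _ _) ⟩
    u % b + s b (u / b) + s b q            ≡⟨ cong (_+ s b q) (sym (s-step u)) ⟩
    s b u + s b q                          ∎
    where
    open ≡-Reasoning
    regroup : q * b ^ suc K ≡ q * b ^ K * b
    regroup = trans (cong (q *_) (ℕP.*-comm b (b ^ K))) (sym (ℕP.*-assoc q (b ^ K) b))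
    shift : (u + q * b ^ K * b) / b ≡ u / b + q * b ^ K
    shift = trans (+-distrib-/-∣ʳ u (divides-refl (q * b ^ K))) (cong (λ v → u / b + v) (m*n/n≡m (q * b ^ K) b))
    u/b<b^K : u / b < b ^ K
    u/b<b^K = m<n*o⇒m/o<n (ℕP.<-≤-trans u<b^[1+K] (ℕP.≤-reflexive (ℕP.*-comm b (b ^ K))))

sgn-+ : ∀ a d → sgn (a + d) ≡ sgn a *ℤ sgn d
sgn-+ zero    d = sym (ℤP.*-identityˡ (sgn d))
sgn-+ (suc a) d = trans (cong -_ (sgn-+ a d)) (ℤP.neg-distribˡ-* (sgn a) (sgn d))

sgn-square : ∀ a → sgn a *ℤ sgn a ≡ + 1
sgn-square zero    = refl
sgn-square (suc a) = trans (negate-square (sgn a)) (sgn-square a)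
  where
  open ℤSolver.+-*-Solver
  negate-square : ∀ x → (- x) *ℤ (- x) ≡ x *ℤ x
  negate-square = solve 1 (λ x → (:- x) :* (:- x) := x :* x) refl

summand : ℕ → ℕ → ℕ → ℤ
summand k j r = if r % suc (suc k) ≡ᵇ j then sgn (s (suc k) r) else + 0

S-window : ∀ k j a t →
  S (suc (suc k)) j (t + a) ≡ S (suc (suc k)) j a +ℤ Σ< t (λ u → summand k j (u + a))
S-window k j a zero    = sym (ℤP.+-identityʳ _)
S-window k j a (suc t) =
  trans (cong (_+ℤ summand k j (t + a)) (S-window k j a t))
        (ℤP.+-assoc (S (suc (suc k)) j a) _ (summand k j (t + a)))

if-scale : ∀ (β : Bool) c v → (if β then c *ℤ v else + 0) ≡ c *ℤ (if β then v else + 0)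
if-scale true  c v = refl
if-scale false c v = sym (ℤP.*-zeroʳ c)

module Period (c : ℕ) where
  open Digits c

  n Mₙ : ℕ
  n = suc b
  Mₙ = M n

  instance
    Mₙ≢0 : NonZero Mₙ
    Mₙ≢0 = ℕP.m^n≢0 b b

  χ : ℕ → ℤ
  χ r = sgn (s b r)

  χ-block : ∀ q u → u < Mₙ → χ (u + q * Mₙ) ≡ χ u *ℤ χ q
  χ-block q u u<Mₙ = trans (cong sgn (s-block b q u u<Mₙ)) (sgn-+ (s b u) (s b q))

  hit : ℕ → ℕ → ℤ
  hit q u = if (u + q * Mₙ) % n ≡ᵇ 0 then χ u else + 0

  summand-block : ∀ q u → u < Mₙ → summand (suc c) 0 (u + q * Mₙ) ≡ χ q *ℤ hit q u
  summand-block q u u<Mₙ = trans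
    (cong (λ v → if (u + q * Mₙ) % n ≡ᵇ 0 then v else + 0)
          (trans (χ-block q u u<Mₙ) (ℤP.*-comm (χ u) (χ q))))
    (if-scale ((u + q * Mₙ) % n ≡ᵇ 0) (χ q) (χ u))

  Δ-block : ∀ q t → t < Mₙ → Δ n (t + q * Mₙ) ≡ χ q *ℤ Σ< t (hit q)
  Δ-block q t t<Mₙ = begin
    S n 0 (t + q * Mₙ) -ℤ S n 0 (Mₙ * ((t + q * Mₙ) / Mₙ))
      ≡⟨ cong (λ v → S n 0 (t + q * Mₙ) -ℤ S n 0 v)
              (trans (cong (Mₙ *_) (quotient-unique q t<Mₙ)) (ℕP.*-comm Mₙ q)) ⟩
    S n 0 (t + q * Mₙ) -ℤ S n 0 (q * Mₙ)
      ≡⟨ cong (_-ℤ S n 0 (q * Mₙ)) (S-window (suc c) 0 (q * Mₙ) t) ⟩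
    (S n 0 (q * Mₙ) +ℤ Σ< t (λ u → summand (suc c) 0 (u + q * Mₙ))) -ℤ S n 0 (q * Mₙ)
      ≡⟨ add-sub-cancel (S n 0 (q * Mₙ)) _ ⟩
    Σ< t (λ u → summand (suc c) 0 (u + q * Mₙ))
      ≡⟨ Σ<-cong t (λ u u<t → summand-block q u (ℕP.<-trans u<t t<Mₙ)) ⟩
    Σ< t (λ u → χ q *ℤ hit q u)
      ≡⟨ Σ<-scale (χ q) t (hit q) ⟩
    χ q *ℤ Σ< t (hit q)
      ∎
    where
    open ≡-Reasoning
    open ℤSolver.+-*-Solver
    add-sub-cancel : ∀ a h → (a +ℤ h) -ℤ a ≡ h
    add-sub-cancel = solve 2 (λ a h → (a :+ h) :- a := h) refl

  -- The block formula: χ(q) cancels, leaving a quantity that sees q only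
  -- through the divisibility conditions in `hit q`.
  f-block : ∀ q t → t < Mₙ → f n (t + q * Mₙ) ≡ χ t *ℤ Σ< t (hit q)
  f-block q t t<Mₙ = begin
    χ (t + q * Mₙ) *ℤ Δ n (t + q * Mₙ)         ≡⟨ cong₂ _*ℤ_ (χ-block q t t<Mₙ) (Δ-block q t t<Mₙ) ⟩
    (χ t *ℤ χ q) *ℤ (χ q *ℤ Σ< t (hit q))     ≡⟨ regroup (χ t) (χ q) (Σ< t (hit q)) ⟩
    χ t *ℤ ((χ q *ℤ χ q) *ℤ Σ< t (hit q))     ≡⟨ cong (λ v → χ t *ℤ (v *ℤ Σ< t (hit q))) (sgn-square (s b q)) ⟩
    χ t *ℤ (+ 1 *ℤ Σ< t (hit q))              ≡⟨ cong (χ t *ℤ_) (ℤP.*-identityˡ (Σ< t (hit q))) ⟩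
    χ t *ℤ Σ< t (hit q)                       ∎
    where
    open ≡-Reasoning
    open ℤSolver.+-*-Solver
    regroup : ∀ a e h → (a *ℤ e) *ℤ (e *ℤ h) ≡ a *ℤ ((e *ℤ e) *ℤ h)
    regroup = solve 3 (λ a e h → (a :* e) :* (e :* h) := a :* ((e :* e) :* h)) refl

  -- Moving n blocks ahead does not change residues mod n, since n ∣ n·Mₙ.
  hit-periodic : ∀ q u → hit (q + n) u ≡ hit q u
  hit-periodic q u = cong (λ r → if r ≡ᵇ 0 then χ u else + 0)
    (trans (cong (_% n) (regroup u q n Mₙ)) ([m+kn]%n≡m%n (u + q * Mₙ) Mₙ n))
    where
    open ℕSolver.+-*-Solver
    regroup : ∀ u q k m → u + (q + k) * m ≡ (u + q * m) + m * k
    regroup = solve 4 (λ u q k m → u :+ (q :+ k) :* m := (u :+ q :* m) :+ m :* k) refl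

  periodic : ∀ x → f n (x + n * Mₙ) ≡ f n x
  periodic x = begin
    f n (x + n * Mₙ)                 ≡⟨ cong (λ y → f n (y + n * Mₙ)) x≡t+qM ⟩
    f n ((t + q * Mₙ) + n * Mₙ)       ≡⟨ cong (f n) (regroup t q n Mₙ) ⟩
    f n (t + (q + n) * Mₙ)           ≡⟨ f-block (q + n) t t<Mₙ ⟩
    χ t *ℤ Σ< t (hit (q + n))       ≡⟨ cong (χ t *ℤ_) (Σ<-cong t (λ u _ → hit-periodic q u)) ⟩
    χ t *ℤ Σ< t (hit q)             ≡⟨ sym (f-block q t t<Mₙ) ⟩
    f n (t + q * Mₙ)                 ≡⟨ cong (f n) (sym x≡t+qM) ⟩
    f n x                           ∎
    where
    open ≡-Reasoning
    open ℕSolver.+-*-Solver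
    q t : ℕ
    q = x / Mₙ
    t = x % Mₙ
    t<Mₙ : t < Mₙ
    t<Mₙ = m%n<n x Mₙ
    x≡t+qM : x ≡ t + q * Mₙ
    x≡t+qM = m≡m%n+[m/n]*n x Mₙ
    regroup : ∀ t q k m → (t + q * m) + k * m ≡ t + (q + k) * m
    regroup = solve 4 (λ t q k m → (t :+ q :* m) :+ k :* m := t :+ (q :+ k) :* m) refl

lemma6 : (n : ℕ) → 3 ≤ n → (x : ℕ) →
    f n (x + n * (n ∸ 1) ^ (n ∸ 1)) ≡ f n x
lemma6 (suc (suc (suc c))) (s≤s (s≤s (s≤s _))) = Period.periodic c
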